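{- Let $p$ be a prime and $k$ a positive integer. Then $p\nmid S(pk,k)$ if and only if $k$ is $p$-Fibbinary.
   Context: $S(n,k)$ is the Stirling number of the second kind. A nonnegative integer $k$ is called $p$-Fibbinary if the sum of any two consecutive digits of the base-$p$ representation of $k$ is at most $p-1$ (for $p=2$ this means the binary representation has no two consecutive ones). -}

module Defs where

open import Data.Nat using (ℕ; zero; suc; _+_; _*_; _∸_; _^_; _≤_; NonZero)
open import Data.Nat.DivMod using (_/_; _%_)
open import Data.Nat.Properties using (m^n≢0)

S : ℕ → ℕ → ℕ
S zero    zero    = 1
S zero    (suc k) = 0
S (suc n) zero    = 0
S (suc n) (suc k) = suc k * S n (suc k) + S n k

digit : (p : ℕ) .{{_ : NonZero p}} → ℕ → ℕ → ℕ
digit p k i = (_/_ k (p ^ i) ⦃ m^n≢0 p i ⦄) % p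

-- k is p-Fibbinary: any two consecutive base-p digits sum to at most p-1.
-- (Digits beyond the length of the representation are 0, so quantifying
-- over all positions i is equivalent to quantifying over the digits of
-- the representation.)
Fibbinary : (p : ℕ) .{{_ : NonZero p}} → ℕ → Set
Fibbinary p k = ∀ i → digit p k i + digit p k (suc i) ≤ p ∸ 1

module Submission where

-- All computations are modulo p.  Three facts combine:
--  * Stirling side.  The recurrence S(n+1, K+1) = Σⱼ C(n,j)·S(j,K) and
--    (1 + x)^p ≡ 1 + x^p give p ∣ S(p, K) for 1 < K < p, hence the shift rules
--    S(n+p, K) ≡ S(n+1, K) for K < p and S(n+p, K+p) ≡ S(n, K) + S(n+1, K+p).
--    Induction along the bands then gives S(s(p-1) + K, K) ≡ C(q+s, q) for
--    K = q·p + r with 0 < r ≤ p, and so S(p·k, k) ≡ C(⌊k/p⌋ + k, ⌊k/p⌋)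
--    (for p ∣ k after one absorption step).
--  * Binomial side.  Lucas' theorem, one digit at a time, gives Kummer's carry
--    criterion: p ∤ C(a+b, a) iff adding a and b in base p produces no carry.
--  * Adding ⌊k/p⌋ to k adds to every base-p digit of k the next one, so it
--    is carry-free exactly when k is p-Fibbinary.

open import Defs
open import Data.Nat using (ℕ; _*_; _>_)
open import Data.Nat.Divisibility using (_∣_)
open import Data.Nat.Primality using (Prime; prime⇒nonZero)
open import Relation.Nullary using (¬_)
open import Function.Bundles using (_⇔_)

open import Data.Nat
open import Data.Nat.Properties
open import Data.Nat.DivMod
open import Data.Nat.Divisibility using (n∣m⇒m%n≡0; m%n≡0⇒n∣m; >⇒∤; ∣n⇒∣m*n; divides)
open import Data.Nat.Primality using (prime⇒nonTrivial; euclidsLemma)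
open import Data.Nat.Combinatorics using (_C_; nCn≡1; nC1≡n; k>n⇒nCk≡0; nCk+nC[k+1]≡[n+1]C[k+1])
open import Data.Nat.Induction using (<-wellFounded)
open import Data.Nat.Tactic.RingSolver using (solve-∀)
open import Algebra.Properties.CommutativeSemigroup +-commutativeSemigroup
  using () renaming (interchange to +-interchange; x∙yz≈y∙xz to +-left-commute)
open import Data.Product using (_×_; _,_; proj₁; proj₂)
open import Data.Sum using ([_,_]′; inj₁; inj₂)
open import Data.Empty using (⊥-elim)
open import Function.Base using (id; _∘_)
open import Function.Bundles using (mk⇔; Equivalence)
open Equivalence using (to; from)
open import Function.Properties.Equivalence using () renaming (sym to ⇔-sym)
open import Function.Related.Propositional using (module EquationalReasoning)
open import Induction.WellFounded using (Acc; acc)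
open import Level using (0ℓ)
open import Relation.Nullary using (yes; no)
open import Relation.Binary.Bundles using (Setoid)
open import Relation.Binary.PropositionalEquality
import Relation.Binary.Reasoning.Setoid as SetoidReasoning

pascal : ∀ n k → suc n C suc k ≡ n C k + n C suc k
pascal n k = sym (nCk+nC[k+1]≡[n+1]C[k+1] n k)

-- Absorption identity (k+1)·C(n+1,k+1) = (n+1)·C(n,k); it is what makes
-- a prime p divide C(p,j) for 0 < j < p.
absorption : ∀ n k → suc k * (suc n C suc k) ≡ suc n * (n C k)
absorption zero    zero    = refl
absorption zero    (suc k) = *-zeroʳ (2 + k)
absorption (suc n) zero    = begin
  1 * ((2 + n) C 1) ≡⟨ *-identityˡ _ ⟩
  (2 + n) C 1     ≡⟨ nC1≡n (2 + n) ⟩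
  2 + n           ≡⟨ sym (*-identityʳ (2 + n)) ⟩
  (2 + n) * 1     ∎
  where open ≡-Reasoning
absorption (suc n) (suc k) = begin
  (2 + k) * ((2 + n) C (2 + k))
    ≡⟨ cong ((2 + k) *_) (pascal (suc n) (suc k)) ⟩
  (2 + k) * (a + b)
    ≡⟨ split-first k a b ⟩
  (1 + k) * a + a + (2 + k) * b
    ≡⟨ cong₂ (λ x y → x + a + y) (absorption n k) (absorption n (suc k)) ⟩
  (1 + n) * (n C k) + a + (1 + n) * (n C suc k)
    ≡⟨ cong (λ x → (1 + n) * (n C k) + x + (1 + n) * (n C suc k)) (pascal n k) ⟩
  (1 + n) * (n C k) + (n C k + n C suc k) + (1 + n) * (n C suc k)
    ≡⟨ collect n (n C k) (n C suc k) ⟩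
  (2 + n) * (n C k + n C suc k)
    ≡⟨ cong ((2 + n) *_) (sym (pascal n k)) ⟩
  (2 + n) * ((1 + n) C (1 + k)) ∎
  where
  open ≡-Reasoning
  a = suc n C suc k
  b = suc n C (2 + k)
  split-first : ∀ k a b → (2 + k) * (a + b) ≡ (1 + k) * a + a + (2 + k) * b
  split-first = solve-∀
  collect : ∀ n x y → (1 + n) * x + (x + y) + (1 + n) * y ≡ (2 + n) * (x + y)
  collect = solve-∀

-- For a multiple k = (q+1)·m:  C(q+1 + k, q+1) = (m+1)·C(q + k, q),
-- by absorption, since q+1 + k = (q+1)(m+1).
binomial-multiple : ∀ q m → (suc q + (q * m + m)) C suc q ≡ suc m * ((q + (q * m + m)) C q)
binomial-multiple q m = *-cancelˡ-≡ _ _ (suc q) (begin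
  suc q * (suc n C suc q)          ≡⟨ absorption n q ⟩
  suc n * (n C q)                  ≡⟨ cong (_* (n C q)) (factor q m) ⟩
  suc q * suc m * (n C q)          ≡⟨ *-assoc (suc q) (suc m) (n C q) ⟩
  suc q * (suc m * (n C q))        ∎)
  where
  open ≡-Reasoning
  n = q + (q * m + m)
  factor : ∀ q m → suc (q + (q * m + m)) ≡ suc q * suc m
  factor = solve-∀

shift-row : ∀ p n c → suc n * p + c ≡ n * p + c + p
shift-row = solve-∀

S-below-diagonal : ∀ n k → n < k → S n k ≡ 0
S-below-diagonal zero    (suc k) _         = refl
S-below-diagonal (suc n) (suc k) (s≤s n<k) = begin
  suc k * S n (suc k) + S n k   ≡⟨ cong₂ (λ x y → suc k * x + y)
                                     (S-below-diagonal n (suc k) (m<n⇒m<1+n n<k))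
                                     (S-below-diagonal n k n<k) ⟩
  suc k * 0 + 0                 ≡⟨ cong (_+ 0) (*-zeroʳ (suc k)) ⟩
  0                             ∎
  where open ≡-Reasoning

S-diagonal : ∀ n → S n n ≡ 1
S-diagonal zero    = refl
S-diagonal (suc n) = begin
  suc n * S n (suc n) + S n n   ≡⟨ cong₂ (λ x y → suc n * x + y) (S-below-diagonal n (suc n) ≤-refl) (S-diagonal n) ⟩
  suc n * 0 + 1                 ≡⟨ cong (_+ 1) (*-zeroʳ (suc n)) ⟩
  1                             ∎
  where open ≡-Reasoning

S-no-blocks : ∀ n → 0 < n → S n 0 ≡ 0
S-no-blocks (suc n) _ = refl

S-one-block : ∀ n → S (suc n) 1 ≡ 1
S-one-block zero    = refl
S-one-block (suc n) = trans (+-identityʳ _) (trans (+-identityʳ _) (S-one-block n))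

Σ< : ℕ → (ℕ → ℕ) → ℕ
Σ< zero    g = 0
Σ< (suc n) g = g 0 + Σ< n (g ∘ suc)

Σ<-last : ∀ n g → Σ< (suc n) g ≡ Σ< n g + g n
Σ<-last zero    g = +-comm (g 0) 0
Σ<-last (suc n) g = trans (cong (g 0 +_) (Σ<-last n (g ∘ suc))) (sym (+-assoc (g 0) _ _))

Σ<-cong : ∀ n {g h} → (∀ j → g j ≡ h j) → Σ< n g ≡ Σ< n h
Σ<-cong zero    g≡h = refl
Σ<-cong (suc n) g≡h = cong₂ _+_ (g≡h 0) (Σ<-cong n (g≡h ∘ suc))

Σ<-+ : ∀ n g h → Σ< n (λ j → g j + h j) ≡ Σ< n g + Σ< n h
Σ<-+ zero    g h = refl
Σ<-+ (suc n) g h = trans (cong (g 0 + h 0 +_) (Σ<-+ n (g ∘ suc) (h ∘ suc)))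
                         (+-interchange (g 0) (h 0) _ _)

-- The binomial transform  transform n f = Σ_{j ≤ n} C(n,j)·f(j),  defined by
-- the recursion that Pascal's rule dictates.
transform : ℕ → (ℕ → ℕ) → ℕ
transform zero    f = f 0
transform (suc n) f = transform n f + transform n (f ∘ suc)

transform-linear : ∀ n a g h →
  transform n (λ j → a * g j + h j) ≡ a * transform n g + transform n h
transform-linear zero    a g h = refl
transform-linear (suc n) a g h = begin
  transform n (λ j → a * g j + h j) + transform n (λ j → a * g (suc j) + h (suc j))
    ≡⟨ cong₂ _+_ (transform-linear n a g h) (transform-linear n a (g ∘ suc) (h ∘ suc)) ⟩
  (a * transform n g + transform n h) + (a * transform n (g ∘ suc) + transform n (h ∘ suc))
    ≡⟨ +-interchange (a * transform n g) _ _ _ ⟩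
  (a * transform n g + a * transform n (g ∘ suc)) + (transform n h + transform n (h ∘ suc))
    ≡⟨ cong (_+ transform (suc n) h) (*-distribˡ-+ a (transform n g) _) ⟨
  a * transform (suc n) g + transform (suc n) h
    ∎
  where open ≡-Reasoning

transform-zero : ∀ n → transform n (λ _ → 0) ≡ 0
transform-zero zero    = refl
transform-zero (suc n) = cong₂ _+_ (transform-zero n) (transform-zero n)

transform-expansion : ∀ n f → transform n f ≡ Σ< (suc n) (λ j → (n C j) * f j)
transform-expansion zero    f = sym (trans (+-identityʳ _) (*-identityˡ (f 0)))
transform-expansion (suc n) f = begin
  transform n f + transform n (f ∘ suc)
    ≡⟨ cong₂ _+_ (transform-expansion n f) (transform-expansion n (f ∘ suc)) ⟩
  (1 * f 0 + Σ< n upper) + Σ< (suc n) lower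
    ≡⟨ cong (λ x → (1 * f 0 + x) + Σ< (suc n) lower) (sym (Σ<-last-upper)) ⟩
  (1 * f 0 + Σ< (suc n) upper) + Σ< (suc n) lower
    ≡⟨ +-assoc (1 * f 0) _ _ ⟩
  1 * f 0 + (Σ< (suc n) upper + Σ< (suc n) lower)
    ≡⟨ cong (1 * f 0 +_) (trans (+-comm (Σ< (suc n) upper) _) (sym (Σ<-+ (suc n) lower upper))) ⟩
  1 * f 0 + Σ< (suc n) (λ j → lower j + upper j)
    ≡⟨ cong (1 * f 0 +_) (Σ<-cong (suc n) λ j → sym (trans
         (cong (_* f (suc j)) (pascal n j)) (*-distribʳ-+ (f (suc j)) (n C j) (n C suc j)))) ⟩
  1 * f 0 + Σ< (suc n) (λ j → (suc n C suc j) * f (suc j))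
    ∎
  where
  open ≡-Reasoning
  upper lower : ℕ → ℕ
  upper j = (n C suc j) * f (suc j)
  lower j = (n C j) * f (suc j)
  -- The term j = n of the upper sum vanishes, as C(n, n+1) = 0.
  Σ<-last-upper : Σ< (suc n) upper ≡ Σ< n upper
  Σ<-last-upper = trans (Σ<-last n upper)
    (trans (cong (λ x → Σ< n upper + x * f (suc n)) (k>n⇒nCk≡0 (n<1+n n))) (+-identityʳ _))

-- The recurrence S(n+1, K+1) = Σ_j C(n,j)·S(j,K): the block of the extra
-- element contains n - j of the others, the remaining j form K blocks.
stirling-transform : ∀ n K → S (suc n) (suc K) ≡ transform n (λ j → S j K)
stirling-transform zero    K       = cong (_+ S 0 K) (*-zeroʳ (suc K))
stirling-transform (suc n) zero    = begin
  1 * S (suc n) 1 + 0                    ≡⟨ trans (+-identityʳ _) (*-identityˡ _) ⟩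
  S (suc n) 1                            ≡⟨ stirling-transform n zero ⟩
  transform n (λ j → S j 0)              ≡⟨ +-identityʳ _ ⟨
  transform n (λ j → S j 0) + 0          ≡⟨ cong (transform n (λ j → S j 0) +_) (transform-zero n) ⟨
  transform (suc n) (λ j → S j 0)        ∎
  where open ≡-Reasoning
stirling-transform (suc n) (suc K) = begin
  (2 + K) * S' + S (suc n) (suc K)
    ≡⟨ cong (_+ S (suc n) (suc K)) (+-comm S' (suc K * S')) ⟩
  suc K * S' + S' + S (suc n) (suc K)
    ≡⟨ +-assoc (suc K * S') S' _ ⟩
  suc K * S' + (S' + S (suc n) (suc K))
    ≡⟨ cong₂ (λ x y → suc K * x + (x + y)) (stirling-transform n (suc K)) (stirling-transform n K) ⟩
  suc K * T₁ + (T₁ + T₀)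
    ≡⟨ +-left-commute (suc K * T₁) T₁ T₀ ⟩
  T₁ + (suc K * T₁ + T₀)
    ≡⟨ cong (T₁ +_) (transform-linear n (suc K) (λ j → S j (suc K)) (λ j → S j K)) ⟨
  transform n (λ j → S j (suc K)) + transform n (λ j → suc K * S j (suc K) + S j K)
    ∎
  where
  open ≡-Reasoning
  S' = S (suc n) (2 + K)
  T₁ = transform n (λ j → S j (suc K))
  T₀ = transform n (λ j → S j K)

module Modular (m : ℕ) .{{_ : NonZero m}} where

  -- a ≋ b means a ≡ b (mod m): both leave the same remainder.  It is a
  -- record so that a and b can be inferred from a proof.
  infix 4 _≋_
  record _≋_ (a b : ℕ) : Set where
    constructor same-residue
    field residue-eq : a % m ≡ b % m

  ≡⇒≋ : ∀ {a b} → a ≡ b → a ≋ b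
  ≡⇒≋ a≡b = same-residue (cong (_% m) a≡b)

  ≋-sym : ∀ {a b} → a ≋ b → b ≋ a
  ≋-sym (same-residue e) = same-residue (sym e)

  ≋-trans : ∀ {a b c} → a ≋ b → b ≋ c → a ≋ c
  ≋-trans (same-residue e) (same-residue f) = same-residue (trans e f)

  ≋-setoid : Setoid 0ℓ 0ℓ
  ≋-setoid = record
    { Carrier = ℕ ; _≈_ = _≋_
    ; isEquivalence = record { refl = ≡⇒≋ refl ; sym = ≋-sym ; trans = ≋-trans } }

  module ≋-Reasoning = SetoidReasoning ≋-setoid

  ≋-+ : ∀ {a b c d} → a ≋ b → c ≋ d → a + c ≋ b + d
  ≋-+ {a} {b} {c} {d} (same-residue a≋b) (same-residue c≋d) = same-residue (begin
    (a + c) % m             ≡⟨ %-distribˡ-+ a c m ⟩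
    (a % m + c % m) % m     ≡⟨ cong₂ (λ x y → (x + y) % m) a≋b c≋d ⟩
    (b % m + d % m) % m     ≡⟨ %-distribˡ-+ b d m ⟨
    (b + d) % m             ∎)
    where open ≡-Reasoning

  ≋-* : ∀ {a b c d} → a ≋ b → c ≋ d → a * c ≋ b * d
  ≋-* {a} {b} {c} {d} (same-residue a≋b) (same-residue c≋d) = same-residue (begin
    (a * c) % m             ≡⟨ %-distribˡ-* a c m ⟩
    (a % m * (c % m)) % m   ≡⟨ cong₂ (λ x y → (x * y) % m) a≋b c≋d ⟩
    (b % m * (d % m)) % m   ≡⟨ %-distribˡ-* b d m ⟨
    (b * d) % m             ∎)
    where open ≡-Reasoning

  +-multiple : ∀ a x → a + x * m ≋ a
  +-multiple a x = same-residue ([m+kn]%n≡m%n a x m)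

  -- Congruences can be cancelled additively: a ≡ a + c·m = (a + c) + c·(m-1).
  ≋-cancelʳ : ∀ {a b} c → a + c ≋ b + c → a ≋ b
  ≋-cancelʳ {a} {b} c a+c≋b+c = begin
    a                      ≈⟨ +-multiple a c ⟨
    a + c * m              ≡⟨ regroup a ⟩
    a + c + c * pred m     ≈⟨ ≋-+ a+c≋b+c (≡⇒≋ refl) ⟩
    b + c + c * pred m     ≡⟨ regroup b ⟨
    b + c * m              ≈⟨ +-multiple b c ⟩
    b                      ∎
    where
    open ≋-Reasoning
    regroup : ∀ x → x + c * m ≡ x + c + c * pred m
    regroup x = trans (cong (λ y → x + c * y) (sym (suc-pred m)))
      (trans (cong (x +_) (*-suc c (pred m))) (sym (+-assoc x c _)))

  ∣⇒≋0 : ∀ {a} → m ∣ a → a ≋ 0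
  ∣⇒≋0 {a} m∣a = same-residue (trans (n∣m⇒m%n≡0 a m m∣a) (sym (m*n%n≡0 0 m)))

  ≋0⇒∣ : ∀ {a} → a ≋ 0 → m ∣ a
  ≋0⇒∣ {a} (same-residue a≋0) = m%n≡0⇒n∣m a m (trans a≋0 (m*n%n≡0 0 m))

  ≋-∣ : ∀ {a b} → a ≋ b → m ∣ a → m ∣ b
  ≋-∣ a≋b m∣a = ≋0⇒∣ (≋-trans (≋-sym a≋b) (∣⇒≋0 m∣a))

module Digits (p : ℕ) .{{_ : NonZero p}} where

  euclid : ∀ a → a ≡ a / p * p + a % p
  euclid a = trans (m≡m%n+[m/n]*n a p) (+-comm (a % p) _)

  digit-zero : ∀ a → digit p a 0 ≡ a % p
  digit-zero a = cong (_% p) (n/1≡n a)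

  digit-suc : ∀ a i → digit p a (suc i) ≡ digit p (a / p) i
  digit-suc a i = cong (_% p)
    (sym (m/n/o≡m/[n*o] a p (p ^ i) ⦃ _ ⦄ ⦃ m^n≢0 p i ⦄ ⦃ m^n≢0 p (suc i) ⦄))

  digit-≤ : ∀ a i → digit p a i ≤ p ∸ 1
  digit-≤ a i = <⇒≤pred (m%n<n _ p)

  digit-of-0 : ∀ i → digit p 0 i ≡ 0
  digit-of-0 i = trans (cong (_% p) (0/n≡0 (p ^ i) ⦃ m^n≢0 p i ⦄)) (m*n%n≡0 0 p)

  NoCarry : ℕ → ℕ → Set
  NoCarry a b = ∀ i → digit p a i + digit p b i ≤ p ∸ 1

  noCarry-step : ∀ a b →
    NoCarry a b ⇔ (a % p + b % p ≤ p ∸ 1 × NoCarry (a / p) (b / p))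
  noCarry-step a b = mk⇔ split join
    where
    split : NoCarry a b → a % p + b % p ≤ p ∸ 1 × NoCarry (a / p) (b / p)
    split nc = subst₂ (λ x y → x + y ≤ p ∸ 1) (digit-zero a) (digit-zero b) (nc 0)
             , λ i → subst₂ (λ x y → x + y ≤ p ∸ 1) (digit-suc a i) (digit-suc b i) (nc (suc i))
    join : a % p + b % p ≤ p ∸ 1 × NoCarry (a / p) (b / p) → NoCarry a b
    join (low , high) zero = subst₂ (λ x y → x + y ≤ p ∸ 1)
      (sym (digit-zero a)) (sym (digit-zero b)) low
    join (low , high) (suc i) = subst₂ (λ x y → x + y ≤ p ∸ 1)
      (sym (digit-suc a i)) (sym (digit-suc b i)) (high i)

  noCarry-zero : ∀ b → NoCarry 0 b
  noCarry-zero b i = subst (λ x → x + digit p b i ≤ p ∸ 1) (sym (digit-of-0 i)) (digit-≤ b i)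

  fibbinary⇔noCarry : ∀ k → Fibbinary p k ⇔ NoCarry (k / p) k
  fibbinary⇔noCarry k = mk⇔
    (λ fib i → subst (_≤ p ∸ 1) (reorder i) (fib i))
    (λ nc i → subst (_≤ p ∸ 1) (sym (reorder i)) (nc i))
    where
    reorder : ∀ i → digit p k i + digit p k (suc i) ≡ digit p (k / p) i + digit p k i
    reorder i = trans (+-comm (digit p k i) _) (cong (_+ digit p k i) (digit-suc k i))

-- Binomial coefficients modulo a prime: Lucas' theorem and the carry
-- criterion

module BinomialModPrime (p₁ : ℕ) (p-prime : Prime (suc p₁)) where

  p : ℕ
  p = suc p₁

  open Modular p
  open Digits p

  1<p : 1 < p
  1<p = nonTrivial⇒n>1 p ⦃ prime⇒nonTrivial p-prime ⦄

  p∤small : ∀ k → 0 < k → k < p → ¬ p ∣ k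
  p∤small (suc k) _ k<p = >⇒∤ k<p

  p∤1 : ¬ p ∣ 1
  p∤1 = >⇒∤ 1<p

  ¬∣-cancel : ∀ {x y} → ¬ p ∣ x → (¬ p ∣ x * y) ⇔ (¬ p ∣ y)
  ¬∣-cancel {x} {y} p∤x = mk⇔
    (λ p∤xy p∣y → p∤xy (∣n⇒∣m*n x p∣y))
    (λ p∤y p∣xy → [ p∤x , p∤y ]′ (euclidsLemma x y p-prime p∣xy))

  ≋-¬∣ : ∀ {a b} → a ≋ b → (¬ p ∣ a) ⇔ (¬ p ∣ b)
  ≋-¬∣ a≋b = mk⇔ (λ p∤a p∣b → p∤a (≋-∣ (≋-sym a≋b) p∣b)) (λ p∤b p∣a → p∤b (≋-∣ a≋b p∣a))

  p∣pCj : ∀ j → 0 < j → j < p → p ∣ p C j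
  p∣pCj (suc j) 0<j j<p =
    [ (λ p∣j → ⊥-elim (p∤small (suc j) 0<j j<p p∣j)) , id ]′
      (euclidsLemma (suc j) (p C suc j) p-prime
        (divides (p₁ C j) (trans (absorption p₁ j) (*-comm p (p₁ C j)))))

  p∤nCk : ∀ n k → n < p → k ≤ n → ¬ p ∣ n C k
  p∤nCk n       zero    _   _         = p∤1
  p∤nCk (suc n) (suc k) n<p (s≤s k≤n) p∣C =
    [ p∤small (suc n) z<s n<p , p∤nCk n k (<-trans (n<1+n n) n<p) k≤n ]′
      (euclidsLemma (suc n) (n C k) p-prime
        (subst (p ∣_) (absorption n k) (∣n⇒∣m*n (suc k) p∣C)))

  -- Row n + p of Pascal's triangle modulo p is row n plus row n shifted
  -- by p (since (1 + x)^p ≡ 1 + x^p); below column p only the first part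
  -- contributes, from column p on both do.
  C-shift-low : ∀ n k → k < p → (n + p) C k ≋ n C k
  C-shift-low zero    zero    _   = ≡⇒≋ refl
  C-shift-low zero    (suc k) k<p = ∣⇒≋0 (p∣pCj (suc k) z<s k<p)
  C-shift-low (suc n) zero    _   = ≡⇒≋ refl
  C-shift-low (suc n) (suc k) k<p = begin
    (suc n + p) C suc k              ≡⟨ pascal (n + p) k ⟩
    (n + p) C k + (n + p) C suc k    ≈⟨ ≋-+ (C-shift-low n k (<-trans (n<1+n k) k<p))
                                            (C-shift-low n (suc k) k<p) ⟩
    n C k + n C suc k                ≡⟨ pascal n k ⟨
    suc n C suc k                    ∎
    where open ≋-Reasoning

  C-shift-high : ∀ n k → (n + p) C (k + p) ≋ n C (k + p) + n C k
  C-shift-high zero    zero    = ≡⇒≋ (nCn≡1 p)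
  C-shift-high zero    (suc k) = ≡⇒≋ (k>n⇒nCk≡0 (s≤s (m≤n+m p k)))
  C-shift-high (suc n) zero    = begin
    (suc n + p) C p                  ≡⟨ pascal (n + p) p₁ ⟩
    (n + p) C p₁ + (n + p) C p       ≈⟨ ≋-+ (C-shift-low n p₁ ≤-refl) (C-shift-high n zero) ⟩
    n C p₁ + (n C p + 1)             ≡⟨ +-assoc (n C p₁) (n C p) 1 ⟨
    n C p₁ + n C p + 1               ≡⟨ cong (_+ 1) (pascal n p₁) ⟨
    suc n C p + 1                    ∎
    where open ≋-Reasoning
  C-shift-high (suc n) (suc k) = begin
    (suc n + p) C (suc k + p)
      ≡⟨ pascal (n + p) (k + p) ⟩
    (n + p) C (k + p) + (n + p) C (suc k + p)
      ≈⟨ ≋-+ (C-shift-high n k) (C-shift-high n (suc k)) ⟩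
    (n C (k + p) + n C k) + (n C (suc k + p) + n C suc k)
      ≡⟨ +-interchange (n C (k + p)) (n C k) (n C (suc k + p)) (n C suc k) ⟩
    (n C (k + p) + n C (suc k + p)) + (n C k + n C suc k)
      ≡⟨ cong₂ _+_ (pascal n (k + p)) (pascal n k) ⟨
    suc n C (suc k + p) + suc n C suc k
      ∎
    where open ≋-Reasoning

  lucas : ∀ n k c d → c < p → d < p → (n * p + c) C (k * p + d) ≋ (c C d) * (n C k)
  lucas zero    zero    c d _   _   = ≡⇒≋ (sym (*-identityʳ (c C d)))
  lucas zero    (suc k) c d c<p _   = ≡⇒≋ (trans
    (k>n⇒nCk≡0 (<-≤-trans c<p (≤-trans (m≤m+n p (k * p)) (m≤m+n _ d))))
    (sym (*-zeroʳ (c C d))))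
  lucas (suc n) zero    c d c<p d<p = begin
    (suc n * p + c) C d       ≡⟨ cong (_C d) (shift-row p n c) ⟩
    (n * p + c + p) C d       ≈⟨ C-shift-low (n * p + c) d d<p ⟩
    (n * p + c) C (0 * p + d) ≈⟨ lucas n zero c d c<p d<p ⟩
    (c C d) * 1                ∎
    where open ≋-Reasoning
  lucas (suc n) (suc k) c d c<p d<p = begin
    (suc n * p + c) C (suc k * p + d)
      ≡⟨ cong₂ _C_ (shift-row p n c) (shift-row p k d) ⟩
    (n * p + c + p) C (k * p + d + p)
      ≈⟨ C-shift-high (n * p + c) (k * p + d) ⟩
    (n * p + c) C (k * p + d + p) + (n * p + c) C (k * p + d)
      ≡⟨ cong (λ x → (n * p + c) C x + (n * p + c) C (k * p + d)) (shift-row p k d) ⟨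
    (n * p + c) C (suc k * p + d) + (n * p + c) C (k * p + d)
      ≈⟨ ≋-+ (lucas n (suc k) c d c<p d<p) (lucas n k c d c<p d<p) ⟩
    (c C d) * (n C suc k) + (c C d) * (n C k)
      ≡⟨ trans (+-comm ((c C d) * (n C suc k)) _) (sym (*-distribˡ-+ (c C d) (n C k) (n C suc k))) ⟩
    (c C d) * (n C k + n C suc k)
      ≡⟨ cong ((c C d) *_) (pascal n k) ⟨
    (c C d) * (suc n C suc k)
      ∎
    where open ≋-Reasoning

  sum-split : ∀ a b → a + b ≡ (a / p + b / p) * p + (a % p + b % p)
  sum-split a b = begin
    a + b                                       ≡⟨ cong₂ _+_ (euclid a) (euclid b) ⟩
    (a / p * p + a % p) + (b / p * p + b % p)   ≡⟨ +-interchange (a / p * p) _ _ _ ⟩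
    (a / p * p + b / p * p) + (a % p + b % p)   ≡⟨ cong (_+ (a % p + b % p)) (*-distribʳ-+ p (a / p) (b / p)) ⟨
    (a / p + b / p) * p + (a % p + b % p)       ∎
    where open ≡-Reasoning

  last-digit-no-carry : ∀ a b → a % p + b % p < p →
    (a + b) C a ≋ ((a % p + b % p) C (a % p)) * ((a / p + b / p) C (a / p))
  last-digit-no-carry a b c+d<p = begin
    (a + b) C a
      ≡⟨ cong₂ _C_ (sum-split a b) (euclid a) ⟩
    ((a / p + b / p) * p + (a % p + b % p)) C (a / p * p + a % p)
      ≈⟨ lucas (a / p + b / p) (a / p) _ _ c+d<p (m%n<n a p) ⟩
    ((a % p + b % p) C (a % p)) * ((a / p + b / p) C (a / p))
      ∎
    where open ≋-Reasoning

  -- A carry out of the last digit makes C(a+b, a) divisible by p: the last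
  -- digit of a + b is then smaller than that of a.
  last-digit-carry : ∀ a b → p ≤ a % p + b % p → p ∣ (a + b) C a
  last-digit-carry a b p≤c+d = ≋0⇒∣ (begin
    (a + b) C a
      ≡⟨ cong₂ _C_ (trans (sum-split a b) sum-with-carry) (euclid a) ⟩
    (suc (a / p + b / p) * p + e) C (a / p * p + c)
      ≈⟨ lucas (suc (a / p + b / p)) (a / p) e c (<-trans e<c (m%n<n a p)) (m%n<n a p) ⟩
    (e C c) * (suc (a / p + b / p) C (a / p))
      ≡⟨ cong (_* (suc (a / p + b / p) C (a / p))) (k>n⇒nCk≡0 e<c) ⟩
    0 ∎)
    where
    open ≋-Reasoning
    c = a % p
    d = b % p
    e = c + d ∸ p
    c+d≡e+p : c + d ≡ e + p
    c+d≡e+p = sym (m∸n+n≡m p≤c+d)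
    e<c : e < c
    e<c = +-cancelʳ-< p e c (subst (_< c + p) c+d≡e+p (+-monoʳ-< c (m%n<n b p)))
    sum-with-carry : (a / p + b / p) * p + (c + d) ≡ suc (a / p + b / p) * p + e
    sum-with-carry = trans (cong ((a / p + b / p) * p +_) c+d≡e+p)
      (trans (sym (+-assoc _ e p)) (sym (shift-row p (a / p + b / p) e)))

  carry-criterion : ∀ a b → (¬ p ∣ (a + b) C a) ⇔ NoCarry a b
  carry-criterion a = criterion a (<-wellFounded a)
    where
    criterion : ∀ a → Acc _<_ a → ∀ b → (¬ p ∣ (a + b) C a) ⇔ NoCarry a b
    criterion zero        _          b = mk⇔ (λ _ → noCarry-zero b) (λ _ → p∤1)
    criterion a@(suc _)   (acc rec)  b with a % p + b % p <? p
    ... | yes c+d<p = begin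
      (¬ p ∣ (a + b) C a)
        ∼⟨ ≋-¬∣ (last-digit-no-carry a b c+d<p) ⟩
      (¬ p ∣ ((a % p + b % p) C (a % p)) * ((a / p + b / p) C (a / p)))
        ∼⟨ ¬∣-cancel (p∤nCk _ _ c+d<p (m≤m+n (a % p) (b % p))) ⟩
      (¬ p ∣ (a / p + b / p) C (a / p))
        ∼⟨ criterion (a / p) (rec (m/n<m a p 1<p)) (b / p) ⟩
      NoCarry (a / p) (b / p)
        ∼⟨ mk⇔ (λ nc → from (noCarry-step a b) (<⇒≤pred c+d<p , nc))
               (λ nc → proj₂ (to (noCarry-step a b) nc)) ⟩
      NoCarry a b ∎
      where open EquationalReasoning
    ... | no c+d≮p = mk⇔
      (λ p∤C → ⊥-elim (p∤C (last-digit-carry a b (≮⇒≥ c+d≮p))))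
      (λ nc → ⊥-elim (c+d≮p (s≤s (proj₁ (to (noCarry-step a b) nc)))))

-- Stirling numbers modulo a prime

module StirlingModPrime (p₁ : ℕ) (p-prime : Prime (suc p₁)) where

  open BinomialModPrime p₁ p-prime
  open Modular p
  open Digits p using (euclid)

  Σ<-≋0 : ∀ n g → (∀ j → j < n → g j ≋ 0) → Σ< n g ≋ 0
  Σ<-≋0 zero    g _    = ≡⇒≋ refl
  Σ<-≋0 (suc n) g g≋0 = ≋-+ (g≋0 0 z<s) (Σ<-≋0 n (g ∘ suc) (λ j j<n → g≋0 (suc j) (s≤s j<n)))

  -- Frobenius for the binomial transform, (1 + x)^p ≡ 1 + x^p: only the
  -- outer terms of row p survive modulo p.
  transform-frobenius : ∀ f → transform p f ≋ f 0 + f p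
  transform-frobenius f = begin
    transform p f                           ≡⟨ transform-expansion p f ⟩
    1 * f 0 + Σ< p inner                    ≡⟨ cong (1 * f 0 +_) (Σ<-last p₁ inner) ⟩
    1 * f 0 + (Σ< p₁ inner + (p C p) * f p) ≈⟨ ≋-+ (≡⇒≋ (*-identityˡ (f 0))) (≋-+ inner≋0 last) ⟩
    f 0 + (0 + f p)                         ∎
    where
    open ≋-Reasoning
    inner : ℕ → ℕ
    inner j = (p C suc j) * f (suc j)
    inner≋0 : Σ< p₁ inner ≋ 0
    inner≋0 = Σ<-≋0 p₁ inner λ j j<p₁ →
      ≋-* (∣⇒≋0 (p∣pCj (suc j) z<s (s≤s j<p₁))) (≡⇒≋ {f (suc j)} refl)
    last : (p C p) * f p ≋ f p
    last = ≡⇒≋ (trans (cong (_* f p) (nCn≡1 p)) (*-identityˡ (f p)))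

  -- Row p of the Stirling triangle: (K+1)·S(p, K+1) ≡ S(0, K), comparing the
  -- recurrence at n = p with Frobenius.
  stirling-row-p : ∀ K → suc K * S p (suc K) ≋ S 0 K
  stirling-row-p K = ≋-cancelʳ (S p K) (begin
    S (suc p) (suc K)          ≡⟨ stirling-transform p K ⟩
    transform p (λ j → S j K)  ≈⟨ transform-frobenius (λ j → S j K) ⟩
    S 0 K + S p K              ∎)
    where open ≋-Reasoning

  -- Hence p ∣ S(p, K) for 1 < K < p, since K + 1 is invertible modulo p.
  p∣S[p,K] : ∀ K → 1 < K → K < p → p ∣ S p K
  p∣S[p,K] (suc K) (s≤s 0<K) K<p =
    [ (λ p∣K → ⊥-elim (p∤small (suc K) z<s K<p p∣K)) , id ]′
      (euclidsLemma (suc K) (S p (suc K)) p-prime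
        (≋0⇒∣ (≋-trans (stirling-row-p K) (≡⇒≋ (S-below-diagonal 0 K 0<K)))))

  coefficient-mod : ∀ c x → (c + p) * x ≋ c * x
  coefficient-mod c x = ≋-trans
    (≡⇒≋ (trans (*-distribʳ-+ x c p) (cong (c * x +_) (*-comm p x)))) (+-multiple (c * x) x)

  stirling-shift-low : ∀ m K → K < p → S (m + p) K ≋ S (suc m) K
  stirling-shift-low zero    zero          _   = ≡⇒≋ refl
  stirling-shift-low zero    (suc zero)    _   = ≡⇒≋ (S-one-block p₁)
  stirling-shift-low zero    (suc (suc K)) K<p = ≋-trans
    (∣⇒≋0 (p∣S[p,K] (2 + K) (s≤s z<s) K<p)) (≡⇒≋ (sym (S-below-diagonal 1 (2 + K) (s≤s z<s))))
  stirling-shift-low (suc m) zero          _   = ≡⇒≋ refl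
  stirling-shift-low (suc m) (suc K)       K<p =
    ≋-+ (≋-* (≡⇒≋ {suc K} refl) (stirling-shift-low m (suc K) K<p))
        (stirling-shift-low m K (<-trans (n<1+n K) K<p))

  stirling-shift-high : ∀ m K → S (m + p) (K + p) ≋ S m K + S (suc m) (K + p)
  stirling-shift-high zero    zero    =
    ≡⇒≋ (trans (S-diagonal p) (sym (cong (1 +_) (S-below-diagonal 1 p 1<p))))
  stirling-shift-high zero    (suc K) = ≡⇒≋ (trans
    (S-below-diagonal p (suc K + p) (s≤s (m≤n+m p K)))
    (sym (S-below-diagonal 1 (suc K + p) (s≤s (≤-trans z<s (m≤n+m p K))))))
  stirling-shift-high (suc m) zero    = begin
    p * S (m + p) p + S (m + p) p₁        ≈⟨ ≋-+ (coefficient-mod 0 (S (m + p) p))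
                                                 (stirling-shift-low m p₁ ≤-refl) ⟩
    S (suc m) p₁                          ≈⟨ ≋-+ (coefficient-mod 0 (S (suc m) p)) (≡⇒≋ refl) ⟨
    p * S (suc m) p + S (suc m) p₁        ∎
    where open ≋-Reasoning
  stirling-shift-high (suc m) (suc K) = begin
    (suc K + p) * S (m + p) (suc K + p) + S (m + p) (K + p)
      ≈⟨ ≋-+ (≋-* (≡⇒≋ {suc K + p} refl) (stirling-shift-high m (suc K))) (stirling-shift-high m K) ⟩
    (suc K + p) * (x + y) + (z + w)
      ≡⟨ cong (_+ (z + w)) (*-distribˡ-+ (suc K + p) x y) ⟩
    ((suc K + p) * x + (suc K + p) * y) + (z + w)
      ≡⟨ +-interchange ((suc K + p) * x) _ z w ⟩
    ((suc K + p) * x + z) + ((suc K + p) * y + w)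
      ≈⟨ ≋-+ (≋-+ (coefficient-mod (suc K) x) (≡⇒≋ {z} refl)) (≡⇒≋ refl) ⟩
    (suc K * x + z) + ((suc K + p) * y + w)
      ∎
    where
    open ≋-Reasoning
    x = S m (suc K)
    y = S (suc m) (suc K + p)
    z = S m K
    w = S (suc m) (K + p)

  stirling-near-diagonal : ∀ r → 0 < r → r ≤ p → ∀ s → S (s * p₁ + r) r ≋ 1
  stirling-near-diagonal r       _   _   zero    = ≡⇒≋ (S-diagonal r)
  stirling-near-diagonal (suc r) 0<r r≤p (suc s) with m≤n⇒m<n∨m≡n r≤p
  ... | inj₁ r<p = begin
    S (suc s * p₁ + suc r) (suc r)   ≡⟨ cong (λ n → S n (suc r)) (regroup s r p₁) ⟩
    S (s * p₁ + r + p) (suc r)       ≈⟨ stirling-shift-low (s * p₁ + r) (suc r) r<p ⟩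
    S (suc (s * p₁ + r)) (suc r)     ≡⟨ cong (λ n → S n (suc r)) (+-suc (s * p₁) r) ⟨
    S (s * p₁ + suc r) (suc r)       ≈⟨ stirling-near-diagonal (suc r) 0<r r≤p s ⟩
    1                                ∎
    where
    open ≋-Reasoning
    regroup : ∀ s r p₁ → suc s * p₁ + suc r ≡ s * p₁ + r + suc p₁
    regroup = solve-∀
  ... | inj₂ refl = begin
    S (suc s * p₁ + p) p                         ≈⟨ stirling-shift-high (suc s * p₁) 0 ⟩
    S (suc s * p₁) 0 + S (suc (suc s * p₁)) p    ≡⟨ cong₂ (λ x n → x + S n p) (S-no-blocks _ 0<sp₁) (regroup s p₁) ⟩
    S (s * p₁ + p) p                             ≈⟨ stirling-near-diagonal p z<s ≤-refl s ⟩
    1                                            ∎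
    where
    open ≋-Reasoning
    0<sp₁ : 0 < suc s * p₁
    0<sp₁ = ≤-trans (≤-pred 1<p) (m≤m+n p₁ (s * p₁))
    regroup : ∀ s p₁ → suc (suc s * p₁) ≡ s * p₁ + suc p₁
    regroup = solve-∀

  stirling-band : ∀ r → 0 < r → r ≤ p → ∀ q s → S (s * p₁ + (q * p + r)) (q * p + r) ≋ (q + s) C q
  stirling-band r 0<r r≤p zero    s       = stirling-near-diagonal r 0<r r≤p s
  stirling-band r 0<r r≤p (suc q) zero    = ≡⇒≋ (trans (S-diagonal (suc q * p + r))
    (sym (trans (cong (_C suc q) (+-identityʳ (suc q))) (nCn≡1 (suc q)))))
  stirling-band r 0<r r≤p (suc q) (suc s) = begin
    S (suc s * p₁ + (suc q * p + r)) (suc q * p + r)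
      ≡⟨ cong₂ S (regroup₁ s q r p₁) (shift-row p q r) ⟩
    S (suc s * p₁ + K + p) (K + p)
      ≈⟨ stirling-shift-high (suc s * p₁ + K) K ⟩
    S (suc s * p₁ + K) K + S (suc (suc s * p₁ + K)) (K + p)
      ≡⟨ cong₂ (λ n k → S (suc s * p₁ + K) K + S n k) (regroup₂ s q r p₁) (sym (shift-row p q r)) ⟩
    S (suc s * p₁ + K) K + S (s * p₁ + (suc q * p + r)) (suc q * p + r)
      ≈⟨ ≋-+ (stirling-band r 0<r r≤p q (suc s)) (stirling-band r 0<r r≤p (suc q) s) ⟩
    (q + suc s) C q + (suc q + s) C suc q
      ≡⟨ cong (λ n → (q + suc s) C q + n C suc q) (+-suc q s) ⟨
    (q + suc s) C q + (q + suc s) C suc q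
      ≡⟨ pascal (q + suc s) q ⟨
    (suc q + suc s) C suc q
      ∎
    where
    open ≋-Reasoning
    K = q * p + r
    regroup₁ : ∀ s q r p₁ → suc s * p₁ + (suc q * suc p₁ + r) ≡ suc s * p₁ + (q * suc p₁ + r) + suc p₁
    regroup₁ = solve-∀
    regroup₂ : ∀ s q r p₁ → suc (suc s * p₁ + (q * suc p₁ + r)) ≡ s * p₁ + (suc q * suc p₁ + r)
    regroup₂ = solve-∀

  -- The band formula at s = K, where s·(p-1) + K = p·K.
  stirling-pK : ∀ q r → 0 < r → r ≤ p → S (p * (q * p + r)) (q * p + r) ≋ (q + (q * p + r)) C q
  stirling-pK q r 0<r r≤p = subst (λ n → S n K ≋ (q + K) C q) (split-p K p₁)
    (stirling-band r 0<r r≤p q K)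
    where
    K = q * p + r
    split-p : ∀ K p₁ → K * p₁ + K ≡ suc p₁ * K
    split-p = solve-∀

  -- Write k = q·p + r: for r ≠ 0
  -- this is the band formula; for r = 0 the band formula (with q - 1 and
  -- r = p) gives C(q - 1 + k, q - 1), which binomial-multiple turns into
  -- C(q + k, q) up to the factor p + 1 ≡ 1.
  stirling-binomial : ∀ k → 0 < k → S (p * k) k ≋ (k / p + k) C (k / p)
  stirling-binomial k 0<k with k / p | k % p | euclid k | m%n<n k p
  ... | zero  | zero  | k≡0 | _ = ⊥-elim (<⇒≢ 0<k (sym k≡0))
  ... | suc q | zero  | k≡  | _ = subst (λ n → S (p * n) n ≋ (suc q + n) C suc q) (sym k≡q*p+p) (begin
    S (p * K) K                   ≈⟨ stirling-pK q p z<s ≤-refl ⟩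
    (q + K) C q                   ≈⟨ ≋-trans (coefficient-mod 1 ((q + K) C q)) (≡⇒≋ (*-identityˡ _)) ⟨
    suc p * ((q + K) C q)         ≡⟨ binomial-multiple q p ⟨
    (suc q + K) C suc q           ∎)
    where
    open ≋-Reasoning
    K = q * p + p
    k≡q*p+p : k ≡ K
    k≡q*p+p = trans k≡ (trans (+-identityʳ _) (+-comm p (q * p)))
  ... | q     | suc r | k≡  | r<p = subst (λ n → S (p * n) n ≋ (q + n) C q) (sym k≡)
    (stirling-pK q (suc r) z<s (<⇒≤ r<p))

theorem2p4 : (p k : ℕ) → (pp : Prime p) → k > 0 →
    (¬ (p ∣ S (p * k) k)) ⇔ Fibbinary p ⦃ prime⇒nonZero pp ⦄ k
theorem2p4 zero     k () 0<k
theorem2p4 (suc p₁) k pp 0<k = begin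
  (¬ p ∣ S (p * k) k)               ∼⟨ ≋-¬∣ (stirling-binomial k 0<k) ⟩
  (¬ p ∣ (k / p + k) C (k / p))     ∼⟨ carry-criterion (k / p) k ⟩
  NoCarry (k / p) k                 ∼⟨ ⇔-sym (fibbinary⇔noCarry k) ⟩
  Fibbinary p k                     ∎
  where
  open BinomialModPrime p₁ pp using (p; ≋-¬∣; carry-criterion)
  open StirlingModPrime p₁ pp using (stirling-binomial)
  open Digits p using (NoCarry; fibbinary⇔noCarry)
  open EquationalReasoning
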